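{- Let $n\ge1$, $G=\mathrm{AGL}(n,2)$ acting naturally on $V=\mathbb{F}_2^n$, let $J_n\in\mathrm{GL}(n,2)$ be the upper triangular matrix with $1$'s on the diagonal and superdiagonal and $0$ elsewhere, $\mathbf e_n$ the $n$-th standard basis vector, and $\mathbf c=(J_n,\mathbf e_n)$. Then the centralizer $\mathbf C=C_G(\mathbf c)$ is a regular subgroup of $G$ in its action on $V$ (it is transitive on $V$ and $|\mathbf C|=2^n$).
   Context: $\mathrm{AGL}(n,2)=\mathrm{GL}(n,2)\ltimes V$, elements $(M,v)$, product $(M_1,v_1)(M_2,v_2)=(M_1M_2,v_1+M_1v_2)$, action $(M,v)\cdot w=v+Mw$. -}

module Defs where

open import Data.Nat using (ℕ; zero; suc; _∸_)
open import Data.Nat.Properties using (_≟_)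
open import Data.Bool using (Bool; true; false; _xor_; _∧_)
open import Data.Fin using (Fin; toℕ)
open import Data.Vec using (Vec; []; _∷_; tabulate; lookup; zipWith; map; foldr)
open import Data.Product using (_×_; _,_; Σ; ∃)
open import Data.List using (List; length)
open import Relation.Nullary.Decidable using (⌊_⌋)
open import Relation.Binary.PropositionalEquality using (_≡_)
open import Data.Sum using (_⊎_)

-- The field F₂ is Bool with addition _xor_ and multiplication _∧_.
F₂ : Set
F₂ = Bool

Vect : ℕ → Set
Vect n = Vec F₂ n

-- n×n matrices over F₂, as a vector of rows: lookup (lookup M i) j = M_{ij}.
Mat : ℕ → Set
Mat n = Vec (Vec F₂ n) n

_⊕_ : ∀ {n} → Vect n → Vect n → Vect n
_⊕_ = zipWith _xor_

dot : ∀ {n} → Vect n → Vect n → F₂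
dot u v = foldr _ _xor_ false (zipWith _∧_ u v)

_·ᵥ_ : ∀ {n} → Mat n → Vect n → Vect n
M ·ᵥ v = map (λ row → dot row v) M

column : ∀ {n} → Mat n → Fin n → Vect n
column M j = map (λ row → lookup row j) M

_⊗_ : ∀ {n} → Mat n → Mat n → Mat n
M ⊗ N = map (λ row → tabulate (λ j → dot row (column N j))) M

identity : ∀ n → Mat n
identity n = tabulate (λ i → tabulate (λ j → ⌊ toℕ i ≟ toℕ j ⌋))

IsInvertible : ∀ {n} → Mat n → Set
IsInvertible {n} M = Σ (Mat n) (λ N → (M ⊗ N ≡ identity n) × (N ⊗ M ≡ identity n))

Aff : ℕ → Set
Aff n = Mat n × Vect n

InAGL : ∀ {n} → Aff n → Set
InAGL (M , v) = IsInvertible M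

_∘ₐ_ : ∀ {n} → Aff n → Aff n → Aff n
(M₁ , v₁) ∘ₐ (M₂ , v₂) = (M₁ ⊗ M₂ , v₁ ⊕ (M₁ ·ᵥ v₂))

act : ∀ {n} → Aff n → Vect n → Vect n
act (M , v) w = v ⊕ (M ·ᵥ w)

Jmat : ∀ n → Mat n
Jmat n = tabulate (λ i → tabulate (λ j →
           ⌊ toℕ j ≟ toℕ i ⌋ Data.Bool.∨ ⌊ toℕ j ≟ suc (toℕ i) ⌋))

eLast : ∀ n → Vect n
eLast n = tabulate (λ i → ⌊ toℕ i ≟ n ∸ 1 ⌋)

cElt : ∀ n → Aff n
cElt n = (Jmat n , eLast n)

InCentralizer : ∀ n → Aff n → Set
InCentralizer n g = InAGL g × (g ∘ₐ cElt n ≡ cElt n ∘ₐ g)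

{-# OPTIONS --safe #-}
module Submission where

-- Write Jₙ = 1 + S with S the nilpotent shift. Then (M , v) commutes with c = (Jₙ , eₙ) iff
-- M S = S M and M eₙ = eₙ + S v. The first condition makes M an upper triangular Toeplitz
-- matrix, determined by its first row; M eₙ is that row reversed, so the second condition
-- fixes the first row as the reverse of eₙ + S v, whose leading entry is 1. Hence for every v
-- exactly one element of C has translation part v, and it is unitriangular, hence invertible:
-- |C| = 2ⁿ. That element maps 0 to v, so the group C is transitive.

open import Defs
open import Algebra.Bundles using (CommutativeRing)
open import Algebra.Structures using (IsMonoid)
import Algebra.Properties.CommutativeSemigroup as CommutativeSemigroupProperties
open import Data.Bool using (true; false; _xor_; _∧_; _∨_)
open import Data.Bool.Properties
  using ( xor-comm; xor-identityˡ; xor-identityʳ; xor-same; xor-assoc; xor-∧-commutativeRing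
        ; not-injective; ∧-assoc; ∧-identityʳ; ∧-zeroʳ; ∧-distribˡ-xor; ∧-distribʳ-xor )
open import Data.Fin using (Fin; toℕ)
import Data.Fin as Fin
open import Data.List using (List; length; [_]; _++_)
import Data.List as List
import Data.List.Properties as List
open import Data.List.Membership.Propositional using (_∈_)
open import Data.List.Membership.Propositional.Properties using (∈-map⁺; ∈-map⁻; ∈-++⁺ˡ; ∈-++⁺ʳ)
open import Data.List.Relation.Unary.Any using (here)
open import Data.List.Relation.Unary.All using ([])
open import Data.List.Relation.Unary.AllPairs using ([]; _∷_)
open import Data.List.Relation.Unary.Unique.Propositional using (Unique)
import Data.List.Relation.Unary.Unique.Propositional.Properties as Unique
open import Data.Nat using (ℕ; zero; suc; _≤_; _^_; _+_)
import Data.Nat.GeneralisedArithmetic as ℕ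
open import Data.Nat.Properties using (_≟_; +-identityʳ)
open import Data.Empty using (⊥)
open import Data.Product using (_×_; _,_; Σ; proj₁; proj₂)
open import Data.Vec
  using (Vec; []; _∷_; map; zipWith; replicate; tabulate; lookup; iterate; reverse; _∷ʳ_; head; tail; last)
open import Data.Vec.Properties
  using ( ∷-injectiveˡ; ∷-injectiveʳ; map-id; map-const; map-replicate; map-∘; map-cong
        ; zipWith-assoc; zipWith-comm; zipWith-identityˡ; zipWith-identityʳ
        ; tabulate-cong; tabulate-∘; tabulate-allFin; tabulate∘lookup; reverse-∷; reverse-involutive; reverse-injective )
open import Function.Bundles using (_⇔_; mk⇔; Equivalence)
open import Relation.Binary.PropositionalEquality using (_≡_; refl; sym; trans; cong; cong₂; subst; module ≡-Reasoning)
open import Relation.Binary.PropositionalEquality.Algebra using (isMagma)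
open import Relation.Nullary.Decidable using (⌊_⌋; isYes≗does)

open ≡-Reasoning

private
  variable
    A B C : Set

module MonoidUnits {_∙_ : A → A → A} {ε : A} (isMonoid : IsMonoid _≡_ _∙_ ε) where
  open IsMonoid isMonoid using (assoc; identityˡ; identityʳ)

  IsUnit : A → Set
  IsUnit a = Σ _ λ b → a ∙ b ≡ ε × b ∙ a ≡ ε

  isUnit-∙ : ∀ {a b} → IsUnit a → IsUnit b → IsUnit (a ∙ b)
  isUnit-∙ {a} {b} (a⁻¹ , aa⁻¹ , a⁻¹a) (b⁻¹ , bb⁻¹ , b⁻¹b) = b⁻¹ ∙ a⁻¹ , right , left
    where
    right : (a ∙ b) ∙ (b⁻¹ ∙ a⁻¹) ≡ ε
    right = begin
      (a ∙ b) ∙ (b⁻¹ ∙ a⁻¹) ≡⟨ assoc a b _ ⟩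
      a ∙ (b ∙ (b⁻¹ ∙ a⁻¹)) ≡⟨ cong (a ∙_) (assoc b b⁻¹ a⁻¹) ⟨
      a ∙ ((b ∙ b⁻¹) ∙ a⁻¹) ≡⟨ cong (λ x → a ∙ (x ∙ a⁻¹)) bb⁻¹ ⟩
      a ∙ (ε ∙ a⁻¹)         ≡⟨ cong (a ∙_) (identityˡ a⁻¹) ⟩
      a ∙ a⁻¹               ≡⟨ aa⁻¹ ⟩
      ε                     ∎
    left : (b⁻¹ ∙ a⁻¹) ∙ (a ∙ b) ≡ ε
    left = begin
      (b⁻¹ ∙ a⁻¹) ∙ (a ∙ b) ≡⟨ assoc b⁻¹ a⁻¹ _ ⟩
      b⁻¹ ∙ (a⁻¹ ∙ (a ∙ b)) ≡⟨ cong (b⁻¹ ∙_) (assoc a⁻¹ a b) ⟨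
      b⁻¹ ∙ ((a⁻¹ ∙ a) ∙ b) ≡⟨ cong (λ x → b⁻¹ ∙ (x ∙ b)) a⁻¹a ⟩
      b⁻¹ ∙ (ε ∙ b)         ≡⟨ cong (b⁻¹ ∙_) (identityˡ b) ⟩
      b⁻¹ ∙ b               ≡⟨ b⁻¹b ⟩
      ε                     ∎

  leftInverse⇒isUnit : ∀ {a b c} → b ∙ a ≡ ε → c ∙ b ≡ ε → IsUnit a
  leftInverse⇒isUnit {a} {b} {c} ba≡ε cb≡ε = b , trans (cong (_∙ b) (sym c≡a)) cb≡ε , ba≡ε
    where
    c≡a : c ≡ a
    c≡a = begin
      c             ≡⟨ identityʳ c ⟨
      c ∙ ε         ≡⟨ cong (c ∙_) ba≡ε ⟨
      c ∙ (b ∙ a)   ≡⟨ assoc c b a ⟨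
      (c ∙ b) ∙ a   ≡⟨ cong (_∙ a) cb≡ε ⟩
      ε ∙ a         ≡⟨ identityˡ a ⟩
      a             ∎

  ∙-commutes : ∀ {a b c} → a ∙ c ≡ c ∙ a → b ∙ c ≡ c ∙ b → (a ∙ b) ∙ c ≡ c ∙ (a ∙ b)
  ∙-commutes {a} {b} {c} ac≡ca bc≡cb = begin
    (a ∙ b) ∙ c  ≡⟨ assoc a b c ⟩
    a ∙ (b ∙ c)  ≡⟨ cong (a ∙_) bc≡cb ⟩
    a ∙ (c ∙ b)  ≡⟨ assoc a c b ⟨
    (a ∙ c) ∙ b  ≡⟨ cong (_∙ b) ac≡ca ⟩
    (c ∙ a) ∙ b  ≡⟨ assoc c a b ⟩
    c ∙ (a ∙ b)  ∎

  inverse-commutes : ∀ {a b c} → a ∙ b ≡ ε → b ∙ a ≡ ε → a ∙ c ≡ c ∙ a → b ∙ c ≡ c ∙ b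
  inverse-commutes {a} {b} {c} ab≡ε ba≡ε ac≡ca = begin
    b ∙ c                ≡⟨ identityʳ (b ∙ c) ⟨
    (b ∙ c) ∙ ε          ≡⟨ cong ((b ∙ c) ∙_) ab≡ε ⟨
    (b ∙ c) ∙ (a ∙ b)    ≡⟨ assoc b c _ ⟩
    b ∙ (c ∙ (a ∙ b))    ≡⟨ cong (b ∙_) (assoc c a b) ⟨
    b ∙ ((c ∙ a) ∙ b)    ≡⟨ cong (λ x → b ∙ (x ∙ b)) ac≡ca ⟨
    b ∙ ((a ∙ c) ∙ b)    ≡⟨ cong (b ∙_) (assoc a c b) ⟩
    b ∙ (a ∙ (c ∙ b))    ≡⟨ assoc b a _ ⟨
    (b ∙ a) ∙ (c ∙ b)    ≡⟨ cong (_∙ (c ∙ b)) ba≡ε ⟩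
    ε ∙ (c ∙ b)          ≡⟨ identityˡ (c ∙ b) ⟩
    c ∙ b                ∎

pushˡ : ∀ {n} → A → Vec A n → Vec A n
pushˡ a []       = []
pushˡ a (x ∷ xs) = a ∷ pushˡ x xs

pushʳ : ∀ {n} → A → Vec A n → Vec A n
pushʳ a []       = []
pushʳ a (x ∷ xs) = xs ∷ʳ a

zipWith-cancelˡ : {f : A → B → C} → (∀ a {x y} → f a x ≡ f a y → x ≡ y) →
                  ∀ {n} (as : Vec A n) {xs ys} → zipWith f as xs ≡ zipWith f as ys → xs ≡ ys
zipWith-cancelˡ cancel []       {[]}     {[]}     _  = refl
zipWith-cancelˡ cancel (a ∷ as) {x ∷ xs} {y ∷ ys} eq =
  cong₂ _∷_ (cancel a (∷-injectiveˡ eq)) (zipWith-cancelˡ cancel as (∷-injectiveʳ eq))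

iterate-∷ʳ : ∀ (f : A → A) x n → iterate f x (suc n) ≡ iterate f x n ∷ʳ ℕ.iterate f x n
iterate-∷ʳ f x zero    = refl
iterate-∷ʳ f x (suc n) = cong (x ∷_) (iterate-∷ʳ f (f x) n)

map-iterate : ∀ (f : A → A) x n → map f (iterate f x n) ≡ iterate f (f x) n
map-iterate f x zero    = refl
map-iterate f x (suc n) = cong (f x ∷_) (map-iterate f (f x) n)

iterate-pushˡ-∷ : ∀ {m} (a : A) (xs : Vec A m) n →
                  iterate (pushˡ a) (a ∷ xs) n ≡ map (a ∷_) (iterate (pushˡ a) xs n)
iterate-pushˡ-∷ a xs zero    = refl
iterate-pushˡ-∷ a xs (suc n) = cong ((a ∷ xs) ∷_) (iterate-pushˡ-∷ a (pushˡ a xs) n)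

ℕ-iterate-pushˡ-∷ : ∀ {m} (a : A) (xs : Vec A m) n →
                    ℕ.iterate (pushˡ a) (a ∷ xs) n ≡ a ∷ ℕ.iterate (pushˡ a) xs n
ℕ-iterate-pushˡ-∷ a xs zero    = refl
ℕ-iterate-pushˡ-∷ a xs (suc n) = ℕ-iterate-pushˡ-∷ a (pushˡ a xs) n

ℕ-iterate-pushˡ-length : ∀ {n} (a : A) (xs : Vec A n) → ℕ.iterate (pushˡ a) xs n ≡ replicate n a
ℕ-iterate-pushˡ-length a []                     = refl
ℕ-iterate-pushˡ-length {n = suc n} a (x ∷ xs) =
  trans (ℕ-iterate-pushˡ-∷ a (pushˡ x xs) n) (cong (a ∷_) (ℕ-iterate-pushˡ-length a (pushˡ x xs)))

map≡pushʳ⇒iterate : ∀ {n} (f : A → A) d (xs : Vec A (suc n)) →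
                    map f xs ≡ pushʳ d xs → xs ≡ iterate f (head xs) (suc n)
map≡pushʳ⇒iterate f d (x ∷ [])     _  = refl
map≡pushʳ⇒iterate f d (x ∷ y ∷ xs) eq = cong (x ∷_) (begin
  y ∷ xs                    ≡⟨ map≡pushʳ⇒iterate f d (y ∷ xs) (∷-injectiveʳ eq) ⟩
  iterate f y (suc _)       ≡⟨ cong (λ z → iterate f z (suc _)) (∷-injectiveˡ eq) ⟨
  iterate f (f x) (suc _)   ∎)

reverse-pushˡ : ∀ {n} (x : A) (xs : Vec A n) → reverse (x ∷ xs) ≡ last (x ∷ xs) ∷ reverse (pushˡ x xs)
reverse-pushˡ x []       = refl
reverse-pushˡ x (y ∷ xs) = begin
  reverse (x ∷ y ∷ xs)                          ≡⟨ reverse-∷ x (y ∷ xs) ⟩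
  reverse (y ∷ xs) ∷ʳ x                         ≡⟨ cong (_∷ʳ x) (reverse-pushˡ y xs) ⟩
  last (y ∷ xs) ∷ (reverse (pushˡ y xs) ∷ʳ x)   ≡⟨ cong (last (y ∷ xs) ∷_) (reverse-∷ x (pushˡ y xs)) ⟨
  last (x ∷ y ∷ xs) ∷ reverse (x ∷ pushˡ y xs)  ∎

map-last-iterate-pushˡ : ∀ {n} (a : A) (xs : Vec A (suc n)) →
                         map last (iterate (pushˡ a) xs (suc n)) ≡ reverse xs
map-last-iterate-pushˡ a (x ∷ [])                 = refl
map-last-iterate-pushˡ {n = suc n} a (x ∷ y ∷ xs) = begin
  last (y ∷ xs) ∷ map last (iterate (pushˡ a) (a ∷ ys) (suc n))
    ≡⟨ cong (λ rows → last (y ∷ xs) ∷ map last rows) (iterate-pushˡ-∷ a ys (suc n)) ⟩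
  last (y ∷ xs) ∷ map last (map (a ∷_) (iterate (pushˡ a) ys (suc n)))
    ≡⟨ cong (last (y ∷ xs) ∷_) (map-∘ last (a ∷_) _) ⟨
  last (y ∷ xs) ∷ map last (iterate (pushˡ a) ys (suc n))
    ≡⟨ cong (last (y ∷ xs) ∷_) (map-last-iterate-pushˡ a ys) ⟩
  last (y ∷ xs) ∷ reverse ys
    ≡⟨ reverse-pushˡ x (y ∷ xs) ⟨
  reverse (x ∷ y ∷ xs) ∎
  where
  ys = pushˡ x (y ∷ xs)

reverse-∷-reverse : ∀ {n} (x : A) (xs : Vec A n) → reverse (x ∷ reverse xs) ≡ xs ∷ʳ x
reverse-∷-reverse x xs = trans (reverse-∷ x (reverse xs)) (cong (_∷ʳ x) (reverse-involutive xs))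

open CommutativeSemigroupProperties (CommutativeRing.+-commutativeSemigroup xor-∧-commutativeRing)
  using () renaming (interchange to xor-interchange)

xor-cancelˡ : ∀ a {x y} → a xor x ≡ a xor y → x ≡ y
xor-cancelˡ false eq = eq
xor-cancelˡ true  eq = not-injective eq

zeros : ∀ n → Vect n
zeros n = replicate n false

⊕-assoc : ∀ {n} (x y z : Vect n) → (x ⊕ y) ⊕ z ≡ x ⊕ (y ⊕ z)
⊕-assoc = zipWith-assoc xor-assoc

⊕-comm : ∀ {n} (x y : Vect n) → x ⊕ y ≡ y ⊕ x
⊕-comm = zipWith-comm xor-comm

⊕-identityˡ : ∀ {n} (x : Vect n) → zeros n ⊕ x ≡ x
⊕-identityˡ = zipWith-identityˡ xor-identityˡ

⊕-identityʳ : ∀ {n} (x : Vect n) → x ⊕ zeros n ≡ x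
⊕-identityʳ = zipWith-identityʳ xor-identityʳ

⊕-self : ∀ {n} (x : Vect n) → x ⊕ x ≡ zeros n
⊕-self []      = refl
⊕-self (a ∷ x) = cong₂ _∷_ (xor-same a) (⊕-self x)

⊕-interchange : ∀ {n} (w x y z : Vect n) → (w ⊕ x) ⊕ (y ⊕ z) ≡ (w ⊕ y) ⊕ (x ⊕ z)
⊕-interchange []      []      []      []      = refl
⊕-interchange (a ∷ w) (b ∷ x) (c ∷ y) (d ∷ z) =
  cong₂ _∷_ (xor-interchange a b c d) (⊕-interchange w x y z)

⊕-cancelˡ : ∀ {n} (a : Vect n) {x y} → a ⊕ x ≡ a ⊕ y → x ≡ y
⊕-cancelˡ = zipWith-cancelˡ xor-cancelˡ

tabulate-false : ∀ {n} → tabulate {n = n} (λ _ → false) ≡ zeros n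
tabulate-false = trans (tabulate-allFin _) (map-const _ false)

tabulate-xor : ∀ {n} (f g : Fin n → F₂) → tabulate (λ j → f j xor g j) ≡ tabulate f ⊕ tabulate g
tabulate-xor {zero}  f g = refl
tabulate-xor {suc n} f g =
  cong ((f Fin.zero xor g Fin.zero) ∷_) (tabulate-xor (λ j → f (Fin.suc j)) (λ j → g (Fin.suc j)))

infixr 30 _*ₛ_

_*ₛ_ : ∀ {n} → F₂ → Vect n → Vect n
a *ₛ x = map (a ∧_) x

*ₛ-identityˡ : ∀ {n} (x : Vect n) → true *ₛ x ≡ x
*ₛ-identityˡ = map-id

*ₛ-zeroˡ : ∀ {n} (x : Vect n) → false *ₛ x ≡ zeros n
*ₛ-zeroˡ x = map-const x false

*ₛ-zeroʳ : ∀ {n} a → a *ₛ zeros n ≡ zeros n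
*ₛ-zeroʳ {n} a = trans (map-replicate (a ∧_) false n) (cong (replicate n) (∧-zeroʳ a))

*ₛ-assoc : ∀ {n} a b (x : Vect n) → (a ∧ b) *ₛ x ≡ a *ₛ b *ₛ x
*ₛ-assoc a b []      = refl
*ₛ-assoc a b (c ∷ x) = cong₂ _∷_ (∧-assoc a b c) (*ₛ-assoc a b x)

*ₛ-distribˡ-⊕ : ∀ {n} a (x y : Vect n) → a *ₛ (x ⊕ y) ≡ (a *ₛ x) ⊕ (a *ₛ y)
*ₛ-distribˡ-⊕ a []      []      = refl
*ₛ-distribˡ-⊕ a (b ∷ x) (c ∷ y) = cong₂ _∷_ (∧-distribˡ-xor a b c) (*ₛ-distribˡ-⊕ a x y)

*ₛ-distribʳ-xor : ∀ {n} a b (x : Vect n) → (a xor b) *ₛ x ≡ (a *ₛ x) ⊕ (b *ₛ x)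
*ₛ-distribʳ-xor a b []      = refl
*ₛ-distribʳ-xor a b (c ∷ x) = cong₂ _∷_ (∧-distribʳ-xor c a b) (*ₛ-distribʳ-xor a b x)

tabulate-*ₛ : ∀ {n} a (x : Vect n) → tabulate (λ j → a ∧ lookup x j) ≡ a *ₛ x
tabulate-*ₛ a x = trans (tabulate-∘ (a ∧_) (lookup x)) (cong (a *ₛ_) (tabulate∘lookup x))

dot-zerosˡ : ∀ {n} (x : Vect n) → dot (zeros n) x ≡ false
dot-zerosˡ []      = refl
dot-zerosˡ (a ∷ x) = dot-zerosˡ x

dot-zerosʳ : ∀ {n} (x : Vect n) → dot x (zeros n) ≡ false
dot-zerosʳ []      = refl
dot-zerosʳ (a ∷ x) = cong₂ _xor_ (∧-zeroʳ a) (dot-zerosʳ x)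

dot-distribˡ-⊕ : ∀ {n} (x y z : Vect n) → dot x (y ⊕ z) ≡ dot x y xor dot x z
dot-distribˡ-⊕ []      []      []      = refl
dot-distribˡ-⊕ (a ∷ x) (b ∷ y) (c ∷ z) =
  trans (cong₂ _xor_ (∧-distribˡ-xor a b c) (dot-distribˡ-⊕ x y z)) (xor-interchange (a ∧ b) (a ∧ c) _ _)

dot-distribʳ-⊕ : ∀ {n} (x y z : Vect n) → dot (x ⊕ y) z ≡ dot x z xor dot y z
dot-distribʳ-⊕ []      []      []      = refl
dot-distribʳ-⊕ (a ∷ x) (b ∷ y) (c ∷ z) =
  trans (cong₂ _xor_ (∧-distribʳ-xor c a b) (dot-distribʳ-⊕ x y z)) (xor-interchange (a ∧ c) (b ∧ c) _ _)

dot-*ₛ : ∀ {n} a (x y : Vect n) → dot (a *ₛ x) y ≡ a ∧ dot x y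
dot-*ₛ a []      []      = sym (∧-zeroʳ a)
dot-*ₛ a (b ∷ x) (c ∷ y) =
  trans (cong₂ _xor_ (∧-assoc a b c) (dot-*ₛ a x y)) (sym (∧-distribˡ-xor a (b ∧ c) _))

Matrix : ℕ → ℕ → Set
Matrix m n = Vec (Vect n) m

infixl 30 _ᵥ·_ _·ᵣ_

_ᵥ·_ : ∀ {m n} → Vect m → Matrix m n → Vect n
[]      ᵥ· []      = zeros _
(a ∷ x) ᵥ· (r ∷ R) = (a *ₛ r) ⊕ (x ᵥ· R)

-- The rectangular version of _·ᵥ_; on square matrices the two agree definitionally.
_·ᵣ_ : ∀ {m n} → Matrix m n → Vect n → Vect m
R ·ᵣ x = map (λ row → dot row x) R

zeros-ᵥ· : ∀ {m n} (R : Matrix m n) → zeros m ᵥ· R ≡ zeros n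
zeros-ᵥ· []      = refl
zeros-ᵥ· (r ∷ R) = trans (cong₂ _⊕_ (*ₛ-zeroˡ r) (zeros-ᵥ· R)) (⊕-identityˡ _)

false∷-ᵥ· : ∀ {m n} (x : Vect m) (r : Vect n) R → (false ∷ x) ᵥ· (r ∷ R) ≡ x ᵥ· R
false∷-ᵥ· x r R = trans (cong (_⊕ (x ᵥ· R)) (*ₛ-zeroˡ r)) (⊕-identityˡ _)

map-false∷-ᵥ· : ∀ {k m n} (r : Vect n) (R : Matrix m n) (X : Matrix k m) →
                map (_ᵥ· (r ∷ R)) (map (false ∷_) X) ≡ map (_ᵥ· R) X
map-false∷-ᵥ· r R X = trans (sym (map-∘ _ _ X)) (map-cong (λ x → false∷-ᵥ· x r R) X)

ᵥ·-map-false∷ : ∀ {m n} (x : Vect m) (R : Matrix m n) → x ᵥ· map (false ∷_) R ≡ false ∷ (x ᵥ· R)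
ᵥ·-map-false∷ []      []      = refl
ᵥ·-map-false∷ (a ∷ x) (r ∷ R) =
  trans (cong ((a *ₛ (false ∷ r)) ⊕_) (ᵥ·-map-false∷ x R))
        (cong (_∷ ((a *ₛ r) ⊕ (x ᵥ· R))) (trans (xor-identityʳ (a ∧ false)) (∧-zeroʳ a)))

ᵥ·-distribʳ-⊕ : ∀ {m n} (x y : Vect m) (R : Matrix m n) → (x ⊕ y) ᵥ· R ≡ (x ᵥ· R) ⊕ (y ᵥ· R)
ᵥ·-distribʳ-⊕ []      []      []      = sym (⊕-identityˡ _)
ᵥ·-distribʳ-⊕ (a ∷ x) (b ∷ y) (r ∷ R) =
  trans (cong₂ _⊕_ (*ₛ-distribʳ-xor a b r) (ᵥ·-distribʳ-⊕ x y R)) (⊕-interchange _ _ _ _)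

*ₛ-ᵥ· : ∀ {m n} a (x : Vect m) (R : Matrix m n) → (a *ₛ x) ᵥ· R ≡ a *ₛ (x ᵥ· R)
*ₛ-ᵥ· a []      []      = sym (*ₛ-zeroʳ a)
*ₛ-ᵥ· a (b ∷ x) (r ∷ R) =
  trans (cong₂ _⊕_ (*ₛ-assoc a b r) (*ₛ-ᵥ· a x R)) (sym (*ₛ-distribˡ-⊕ a _ _))

ᵥ·-assoc : ∀ {k m n} (x : Vect k) (R : Matrix k m) (S : Matrix m n) →
           (x ᵥ· R) ᵥ· S ≡ x ᵥ· map (_ᵥ· S) R
ᵥ·-assoc []      []      S = zeros-ᵥ· S
ᵥ·-assoc (a ∷ x) (r ∷ R) S =
  trans (ᵥ·-distribʳ-⊕ (a *ₛ r) (x ᵥ· R) S) (cong₂ _⊕_ (*ₛ-ᵥ· a r S) (ᵥ·-assoc x R S))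

dot-ᵥ· : ∀ {m n} (x : Vect m) (R : Matrix m n) (y : Vect n) → dot (x ᵥ· R) y ≡ dot x (R ·ᵣ y)
dot-ᵥ· []      []      y = dot-zerosˡ y
dot-ᵥ· (a ∷ x) (r ∷ R) y =
  trans (dot-distribʳ-⊕ (a *ₛ r) (x ᵥ· R) y) (cong₂ _xor_ (dot-*ₛ a r y) (dot-ᵥ· x R y))

·ᵣ-distribˡ-⊕ : ∀ {m n} (R : Matrix m n) (x y : Vect n) → R ·ᵣ (x ⊕ y) ≡ (R ·ᵣ x) ⊕ (R ·ᵣ y)
·ᵣ-distribˡ-⊕ []      x y = refl
·ᵣ-distribˡ-⊕ (r ∷ R) x y = cong₂ _∷_ (dot-distribˡ-⊕ r x y) (·ᵣ-distribˡ-⊕ R x y)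

·ᵣ-zeroʳ : ∀ {m n} (R : Matrix m n) → R ·ᵣ zeros n ≡ zeros m
·ᵣ-zeroʳ []      = refl
·ᵣ-zeroʳ (r ∷ R) = cong₂ _∷_ (dot-zerosʳ r) (·ᵣ-zeroʳ R)

tabulate-dot-columns : ∀ {m n} (x : Vect m) (R : Matrix m n) →
                       tabulate (λ j → dot x (map (λ row → lookup row j) R)) ≡ x ᵥ· R
tabulate-dot-columns []      []      = tabulate-false
tabulate-dot-columns (a ∷ x) (r ∷ R) =
  trans (tabulate-xor _ _) (cong₂ _⊕_ (tabulate-*ₛ a r) (tabulate-dot-columns x R))

⊗-rows : ∀ {n} (M N : Mat n) → M ⊗ N ≡ map (_ᵥ· N) M
⊗-rows M N = map-cong (λ row → tabulate-dot-columns row N) M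

≟-suc : ∀ a b → ⌊ suc a ≟ suc b ⌋ ≡ ⌊ a ≟ b ⌋
≟-suc a b = trans (isYes≗does (suc a ≟ suc b)) (sym (isYes≗does (a ≟ b)))

identity-suc : ∀ n → identity (suc n) ≡ (true ∷ zeros n) ∷ map (false ∷_) (identity n)
identity-suc n = cong₂ _∷_ (cong (true ∷_) tabulate-false)
  (trans (tabulate-cong λ i → cong (false ∷_) (tabulate-cong λ j → ≟-suc (toℕ i) (toℕ j)))
         (tabulate-∘ (false ∷_) _))

ᵥ·-identity : ∀ {n} (x : Vect n) → x ᵥ· identity n ≡ x
ᵥ·-identity []              = refl
ᵥ·-identity {suc n} (a ∷ x) = begin
  (a ∷ x) ᵥ· identity (suc n)
    ≡⟨ cong ((a ∷ x) ᵥ·_) (identity-suc n) ⟩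
  (a *ₛ (true ∷ zeros n)) ⊕ (x ᵥ· map (false ∷_) (identity n))
    ≡⟨ cong ((a *ₛ (true ∷ zeros n)) ⊕_) (ᵥ·-map-false∷ x (identity n)) ⟩
  ((a ∧ true) xor false) ∷ ((a *ₛ zeros n) ⊕ (x ᵥ· identity n))
    ≡⟨ cong₂ _∷_ (trans (xor-identityʳ _) (∧-identityʳ a))
                 (trans (cong₂ _⊕_ (*ₛ-zeroʳ a) (ᵥ·-identity x)) (⊕-identityˡ x)) ⟩
  a ∷ x ∎

identity-ᵥ· : ∀ {m n} (R : Matrix m n) → map (_ᵥ· R) (identity m) ≡ R
identity-ᵥ· []              = refl
identity-ᵥ· {suc m} (r ∷ R) = begin
  map (_ᵥ· (r ∷ R)) (identity (suc m))
    ≡⟨ cong (map (_ᵥ· (r ∷ R))) (identity-suc m) ⟩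
  ((true *ₛ r) ⊕ (zeros m ᵥ· R)) ∷ map (_ᵥ· (r ∷ R)) (map (false ∷_) (identity m))
    ≡⟨ cong₂ _∷_ (trans (cong₂ _⊕_ (*ₛ-identityˡ r) (zeros-ᵥ· R)) (⊕-identityʳ r))
                 (trans (map-false∷-ᵥ· r R (identity m)) (identity-ᵥ· R)) ⟩
  r ∷ R ∎

identity-·ᵥ : ∀ {n} (x : Vect n) → identity n ·ᵥ x ≡ x
identity-·ᵥ []              = refl
identity-·ᵥ {suc n} (a ∷ x) = begin
  identity (suc n) ·ᵥ (a ∷ x)
    ≡⟨ cong (_·ᵥ (a ∷ x)) (identity-suc n) ⟩
  (a xor dot (zeros n) x) ∷ map (λ row → dot row (a ∷ x)) (map (false ∷_) (identity n))
    ≡⟨ cong₂ _∷_ (trans (cong (a xor_) (dot-zerosˡ x)) (xor-identityʳ a))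
                 (trans (sym (map-∘ _ _ (identity n))) (identity-·ᵥ x)) ⟩
  a ∷ x ∎

⊗-identityˡ : ∀ {n} (M : Mat n) → identity n ⊗ M ≡ M
⊗-identityˡ M = trans (⊗-rows _ M) (identity-ᵥ· M)

⊗-identityʳ : ∀ {n} (M : Mat n) → M ⊗ identity n ≡ M
⊗-identityʳ M = trans (⊗-rows M _) (trans (map-cong ᵥ·-identity M) (map-id M))

⊗-assoc : ∀ {n} (L M N : Mat n) → (L ⊗ M) ⊗ N ≡ L ⊗ (M ⊗ N)
⊗-assoc L M N = begin
  (L ⊗ M) ⊗ N                         ≡⟨ ⊗-rows (L ⊗ M) N ⟩
  map (_ᵥ· N) (L ⊗ M)                 ≡⟨ cong (map (_ᵥ· N)) (⊗-rows L M) ⟩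
  map (_ᵥ· N) (map (_ᵥ· M) L)         ≡⟨ map-∘ _ _ L ⟨
  map (λ x → (x ᵥ· M) ᵥ· N) L         ≡⟨ map-cong (λ x → ᵥ·-assoc x M N) L ⟩
  map (_ᵥ· map (_ᵥ· N) M) L           ≡⟨ cong (λ P → map (_ᵥ· P) L) (⊗-rows M N) ⟨
  map (_ᵥ· (M ⊗ N)) L                 ≡⟨ ⊗-rows L (M ⊗ N) ⟨
  L ⊗ (M ⊗ N)                         ∎

⊗-·ᵥ : ∀ {n} (M N : Mat n) (x : Vect n) → (M ⊗ N) ·ᵥ x ≡ M ·ᵥ (N ·ᵥ x)
⊗-·ᵥ M N x = begin
  (M ⊗ N) ·ᵥ x                          ≡⟨ cong (_·ᵥ x) (⊗-rows M N) ⟩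
  map (λ row → dot row x) (map (_ᵥ· N) M) ≡⟨ map-∘ _ _ M ⟨
  map (λ row → dot (row ᵥ· N) x) M       ≡⟨ map-cong (λ row → dot-ᵥ· row N x) M ⟩
  M ·ᵥ (N ·ᵥ x)                          ∎

⊗-isMonoid : ∀ n → IsMonoid _≡_ _⊗_ (identity n)
⊗-isMonoid n = record
  { isSemigroup = record { isMagma = isMagma _⊗_ ; assoc = ⊗-assoc }
  ; identity    = ⊗-identityˡ , ⊗-identityʳ
  }

module ⊗-Units {n} = MonoidUnits (⊗-isMonoid n)

-- Upper unitriangular matrices are invertible

data UpperUnitriangular : ∀ {n} → Mat n → Set where
  nil  : UpperUnitriangular []
  cons : ∀ {n} (r : Vect n) {T : Mat n} →
         UpperUnitriangular T → UpperUnitriangular ((true ∷ r) ∷ map (false ∷_) T)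

-- Over F₂ a left inverse of [[1 , r] , [0 , T]] is [[1 , r N] , [0 , N]] when N T = 1.
upperUnitriangular-leftInverse : ∀ {n} {T : Mat n} → UpperUnitriangular T →
                                 Σ (Mat n) λ N → UpperUnitriangular N × N ⊗ T ≡ identity n
upperUnitriangular-leftInverse nil = [] , nil , refl
upperUnitriangular-leftInverse (cons {n} r {T} T-ut) with upperUnitriangular-leftInverse T-ut
... | N , N-ut , NT≡1 = N′ , cons (r ᵥ· N) N-ut , product≡1
  where
  T′ = (true ∷ r) ∷ map (false ∷_) T

  rows-N⊗T : map (_ᵥ· T) N ≡ identity n
  rows-N⊗T = trans (sym (⊗-rows N T)) NT≡1

  rN⊗T : (r ᵥ· N) ᵥ· T ≡ r
  rN⊗T = trans (ᵥ·-assoc r N T) (trans (cong (r ᵥ·_) rows-N⊗T) (ᵥ·-identity r))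

  top : (true ∷ r ᵥ· N) ᵥ· T′ ≡ true ∷ zeros n
  top = begin
    (true *ₛ (true ∷ r)) ⊕ ((r ᵥ· N) ᵥ· map (false ∷_) T)
      ≡⟨ cong₂ _⊕_ (*ₛ-identityˡ (true ∷ r)) (ᵥ·-map-false∷ (r ᵥ· N) T) ⟩
    true ∷ (r ⊕ ((r ᵥ· N) ᵥ· T))   ≡⟨ cong (λ x → true ∷ (r ⊕ x)) rN⊗T ⟩
    true ∷ (r ⊕ r)                 ≡⟨ cong (true ∷_) (⊕-self r) ⟩
    true ∷ zeros n                 ∎

  bottom : map (_ᵥ· T′) (map (false ∷_) N) ≡ map (false ∷_) (identity n)
  bottom = begin
    map (_ᵥ· T′) (map (false ∷_) N)            ≡⟨ map-false∷-ᵥ· (true ∷ r) (map (false ∷_) T) N ⟩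
    map (_ᵥ· map (false ∷_) T) N              ≡⟨ map-cong (λ x → ᵥ·-map-false∷ x T) N ⟩
    map (λ x → false ∷ (x ᵥ· T)) N            ≡⟨ map-∘ (false ∷_) (_ᵥ· T) N ⟩
    map (false ∷_) (map (_ᵥ· T) N)            ≡⟨ cong (map (false ∷_)) rows-N⊗T ⟩
    map (false ∷_) (identity n)               ∎

  N′ = (true ∷ r ᵥ· N) ∷ map (false ∷_) N

  product≡1 : N′ ⊗ T′ ≡ identity (suc n)
  product≡1 = begin
    N′ ⊗ T′                                                    ≡⟨ ⊗-rows N′ T′ ⟩
    ((true ∷ r ᵥ· N) ᵥ· T′) ∷ map (_ᵥ· T′) (map (false ∷_) N)  ≡⟨ cong₂ _∷_ top bottom ⟩
    (true ∷ zeros n) ∷ map (false ∷_) (identity n)             ≡⟨ identity-suc n ⟨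
    identity (suc n)                                           ∎

upperUnitriangular⇒isInvertible : ∀ {n} {T : Mat n} → UpperUnitriangular T → IsInvertible T
upperUnitriangular⇒isInvertible T-ut with upperUnitriangular-leftInverse T-ut
... | N , N-ut , NT≡1 with upperUnitriangular-leftInverse N-ut
... | K , _ , KN≡1 = ⊗-Units.leftInverse⇒isUnit NT≡1 KN≡1

-- Matrices commuting with Jₙ

-- Jₙ = 1 + S with S the nilpotent shift; as x S = pushˡ false x and S M = pushʳ 0 M, this says M S = S M.
IsUpperToeplitz : ∀ {n} → Mat n → Set
IsUpperToeplitz {n} M = map (pushˡ false) M ≡ pushʳ (zeros n) M

toeplitz : ∀ {n} → Vect n → Mat n
toeplitz {n} r = iterate (pushˡ false) r n

toeplitz-isUpperToeplitz : ∀ {n} (r : Vect n) → IsUpperToeplitz (toeplitz r)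
toeplitz-isUpperToeplitz {zero}  [] = refl
toeplitz-isUpperToeplitz {suc n} r  = begin
  map (pushˡ false) (iterate (pushˡ false) r (suc n))
    ≡⟨ map-iterate (pushˡ false) r (suc n) ⟩
  iterate (pushˡ false) (pushˡ false r) (suc n)
    ≡⟨ iterate-∷ʳ (pushˡ false) (pushˡ false r) n ⟩
  iterate (pushˡ false) (pushˡ false r) n ∷ʳ ℕ.iterate (pushˡ false) r (suc n)
    ≡⟨ cong (iterate (pushˡ false) (pushˡ false r) n ∷ʳ_) (ℕ-iterate-pushˡ-length false r) ⟩
  iterate (pushˡ false) (pushˡ false r) n ∷ʳ zeros (suc n) ∎

isUpperToeplitz⇒toeplitz : ∀ {n} (M : Mat (suc n)) → IsUpperToeplitz M → M ≡ toeplitz (head M)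
isUpperToeplitz⇒toeplitz M = map≡pushʳ⇒iterate (pushˡ false) (zeros _) M

toeplitz-upperUnitriangular : ∀ {n} (r : Vect n) → UpperUnitriangular (toeplitz (true ∷ r))
toeplitz-upperUnitriangular []      = cons [] nil
toeplitz-upperUnitriangular (x ∷ r) =
  subst (λ rows → UpperUnitriangular ((true ∷ x ∷ r) ∷ rows))
        (sym (iterate-pushˡ-∷ false (true ∷ pushˡ x r) _))
        (cons (x ∷ r) (toeplitz-upperUnitriangular (pushˡ x r)))

Jmat-suc-suc : ∀ n → Jmat (suc (suc n)) ≡ (true ∷ true ∷ zeros n) ∷ map (false ∷_) (Jmat (suc n))
Jmat-suc-suc n = cong₂ _∷_ (cong (λ r → true ∷ true ∷ r) tabulate-false)
  (trans (tabulate-cong λ i → cong (false ∷_) (tabulate-cong λ j →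
            cong₂ _∨_ (≟-suc (toℕ j) (toℕ i)) (≟-suc (toℕ j) (suc (toℕ i)))))
         (tabulate-∘ (false ∷_) λ i → tabulate λ j → ⌊ toℕ j ≟ toℕ i ⌋ ∨ ⌊ toℕ j ≟ suc (toℕ i) ⌋))

eLast-suc-suc : ∀ n → eLast (suc (suc n)) ≡ false ∷ eLast (suc n)
eLast-suc-suc n = cong (false ∷_) (tabulate-cong λ i → ≟-suc (toℕ i) n)

ᵥ·-Jmat : ∀ {n} (x : Vect n) → x ᵥ· Jmat n ≡ x ⊕ pushˡ false x
ᵥ·-Jmat []                        = refl
ᵥ·-Jmat (a ∷ [])                  = cong (λ b → (b xor false) ∷ []) (∧-identityʳ a)
ᵥ·-Jmat {suc (suc n)} (a ∷ b ∷ x) = begin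
  (a ∷ b ∷ x) ᵥ· Jmat (suc (suc n))
    ≡⟨ cong ((a ∷ b ∷ x) ᵥ·_) (Jmat-suc-suc n) ⟩
  (a *ₛ (true ∷ true ∷ zeros n)) ⊕ ((b ∷ x) ᵥ· map (false ∷_) (Jmat (suc n)))
    ≡⟨ cong ((a *ₛ (true ∷ true ∷ zeros n)) ⊕_)
            (trans (ᵥ·-map-false∷ (b ∷ x) (Jmat (suc n))) (cong (false ∷_) (ᵥ·-Jmat (b ∷ x)))) ⟩
  (a *ₛ (true ∷ true ∷ zeros n)) ⊕ (false ∷ ((b ∷ x) ⊕ (false ∷ pushˡ b x)))
    ≡⟨ cong₂ _∷_ (cong (_xor false) (∧-identityʳ a))
         (cong₂ _∷_ (trans (cong₂ _xor_ (∧-identityʳ a) (xor-identityʳ b)) (xor-comm a b))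
                    (trans (cong (_⊕ (x ⊕ pushˡ b x)) (*ₛ-zeroʳ a)) (⊕-identityˡ _))) ⟩
  (a ∷ b ∷ x) ⊕ pushˡ false (a ∷ b ∷ x) ∎

⊗-Jmat : ∀ {n} (M : Mat n) → M ⊗ Jmat n ≡ zipWith _⊕_ M (map (pushˡ false) M)
⊗-Jmat M = trans (⊗-rows M _) (rows-ᵥ·-Jmat M)
  where
  rows-ᵥ·-Jmat : ∀ {m n} (R : Matrix m n) → map (_ᵥ· Jmat n) R ≡ zipWith _⊕_ R (map (pushˡ false) R)
  rows-ᵥ·-Jmat []      = refl
  rows-ᵥ·-Jmat (r ∷ R) = cong₂ _∷_ (ᵥ·-Jmat r) (rows-ᵥ·-Jmat R)

Jmat-ᵥ·-rows : ∀ {m n} (R : Matrix m n) → map (_ᵥ· R) (Jmat m) ≡ zipWith _⊕_ R (pushʳ (zeros n) R)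
Jmat-ᵥ·-rows []                        = refl
Jmat-ᵥ·-rows (r ∷ [])                  = cong (λ s → (s ⊕ zeros _) ∷ []) (*ₛ-identityˡ r)
Jmat-ᵥ·-rows {suc (suc m)} (r ∷ s ∷ R) = begin
  map (_ᵥ· (r ∷ s ∷ R)) (Jmat (suc (suc m)))
    ≡⟨ cong (map (_ᵥ· (r ∷ s ∷ R))) (Jmat-suc-suc m) ⟩
  ((true *ₛ r) ⊕ ((true *ₛ s) ⊕ (zeros m ᵥ· R))) ∷ map (_ᵥ· (r ∷ s ∷ R)) (map (false ∷_) (Jmat (suc m)))
    ≡⟨ cong₂ _∷_ (cong₂ _⊕_ (*ₛ-identityˡ r) (trans (cong₂ _⊕_ (*ₛ-identityˡ s) (zeros-ᵥ· R)) (⊕-identityʳ s)))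
                 (trans (map-false∷-ᵥ· r (s ∷ R) (Jmat (suc m))) (Jmat-ᵥ·-rows (s ∷ R))) ⟩
  zipWith _⊕_ (r ∷ s ∷ R) (pushʳ (zeros _) (r ∷ s ∷ R)) ∎

Jmat-⊗ : ∀ {n} (M : Mat n) → Jmat n ⊗ M ≡ zipWith _⊕_ M (pushʳ (zeros n) M)
Jmat-⊗ M = trans (⊗-rows _ M) (Jmat-ᵥ·-rows M)

Jmat-·ᵥ : ∀ {n} (v : Vect n) → Jmat n ·ᵥ v ≡ v ⊕ pushʳ false v
Jmat-·ᵥ []                        = refl
Jmat-·ᵥ (x ∷ [])                  = refl
Jmat-·ᵥ {suc (suc n)} (x ∷ y ∷ v) = begin
  Jmat (suc (suc n)) ·ᵥ (x ∷ y ∷ v)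
    ≡⟨ cong (_·ᵥ (x ∷ y ∷ v)) (Jmat-suc-suc n) ⟩
  (x xor (y xor dot (zeros n) v)) ∷ map (λ row → dot row (x ∷ y ∷ v)) (map (false ∷_) (Jmat (suc n)))
    ≡⟨ cong₂ _∷_ (cong (x xor_) (trans (cong (y xor_) (dot-zerosˡ v)) (xor-identityʳ y)))
                 (trans (sym (map-∘ _ _ (Jmat (suc n)))) (Jmat-·ᵥ (y ∷ v))) ⟩
  (x ∷ y ∷ v) ⊕ pushʳ false (x ∷ y ∷ v) ∎

dot-eLast : ∀ {n} (r : Vect (suc n)) → dot r (eLast (suc n)) ≡ last r
dot-eLast (a ∷ [])            = trans (xor-identityʳ (a ∧ true)) (∧-identityʳ a)
dot-eLast {suc n} (a ∷ b ∷ r) = begin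
  dot (a ∷ b ∷ r) (eLast (suc (suc n)))              ≡⟨ cong (dot (a ∷ b ∷ r)) (eLast-suc-suc n) ⟩
  (a ∧ false) xor dot (b ∷ r) (eLast (suc n))        ≡⟨ cong (_xor dot (b ∷ r) (eLast (suc n))) (∧-zeroʳ a) ⟩
  dot (b ∷ r) (eLast (suc n))                        ≡⟨ dot-eLast (b ∷ r) ⟩
  last (b ∷ r)                                       ∎

toeplitz-·ᵥ-eLast : ∀ {n} (r : Vect (suc n)) → toeplitz r ·ᵥ eLast (suc n) ≡ reverse r
toeplitz-·ᵥ-eLast r = trans (map-cong dot-eLast (toeplitz r)) (map-last-iterate-pushˡ false r)

eLast-⊕-pushʳ : ∀ {n} (v : Vect (suc n)) → eLast (suc n) ⊕ pushʳ false v ≡ tail v ∷ʳ true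
eLast-⊕-pushʳ (x ∷ [])            = refl
eLast-⊕-pushʳ {suc n} (x ∷ y ∷ v) =
  trans (cong (_⊕ pushʳ false (x ∷ y ∷ v)) (eLast-suc-suc n)) (cong (y ∷_) (eLast-⊕-pushʳ (y ∷ v)))

Jmat-commutes⇔ : ∀ {n} (M : Mat n) → (M ⊗ Jmat n ≡ Jmat n ⊗ M) ⇔ IsUpperToeplitz M
Jmat-commutes⇔ M = mk⇔
  (λ MJ≡JM → zipWith-cancelˡ ⊕-cancelˡ M (trans (sym (⊗-Jmat M)) (trans MJ≡JM (Jmat-⊗ M))))
  (λ toeplitz-M → trans (⊗-Jmat M) (trans (cong (zipWith _⊕_ M) toeplitz-M) (sym (Jmat-⊗ M))))

translation-commutes⇔ : ∀ {n} (M : Mat n) (v : Vect n) →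
  (v ⊕ (M ·ᵥ eLast n) ≡ eLast n ⊕ (Jmat n ·ᵥ v)) ⇔ (M ·ᵥ eLast n ≡ eLast n ⊕ pushʳ false v)
translation-commutes⇔ {n} M v = mk⇔
  (λ eq → ⊕-cancelˡ v (trans eq e⊕Jv))
  (λ eq → trans (cong (v ⊕_) eq) (sym e⊕Jv))
  where
  e = eLast n
  e⊕Jv : e ⊕ (Jmat n ·ᵥ v) ≡ v ⊕ (e ⊕ pushʳ false v)
  e⊕Jv = begin
    e ⊕ (Jmat n ·ᵥ v)            ≡⟨ cong (e ⊕_) (Jmat-·ᵥ v) ⟩
    e ⊕ (v ⊕ pushʳ false v)      ≡⟨ ⊕-assoc e v _ ⟨
    (e ⊕ v) ⊕ pushʳ false v      ≡⟨ cong (_⊕ pushʳ false v) (⊕-comm e v) ⟩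
    (v ⊕ e) ⊕ pushʳ false v      ≡⟨ ⊕-assoc v e _ ⟩
    v ⊕ (e ⊕ pushʳ false v)      ∎

commutes-cElt⇔ : ∀ {n} (M : Mat n) (v : Vect n) →
  ((M , v) ∘ₐ cElt n ≡ cElt n ∘ₐ (M , v)) ⇔ (IsUpperToeplitz M × M ·ᵥ eLast n ≡ eLast n ⊕ pushʳ false v)
commutes-cElt⇔ M v = mk⇔
  (λ eq → Equivalence.to (Jmat-commutes⇔ M) (cong proj₁ eq)
        , Equivalence.to (translation-commutes⇔ M v) (cong proj₂ eq))
  (λ (toeplitz-M , lastColumn) → cong₂ _,_ (Equivalence.from (Jmat-commutes⇔ M) toeplitz-M)
                                          (Equivalence.from (translation-commutes⇔ M v) lastColumn))

identityₐ : ∀ n → Aff n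
identityₐ n = identity n , zeros n

act-zeros : ∀ {n} (g : Aff n) → act g (zeros n) ≡ proj₂ g
act-zeros (M , v) = trans (cong (v ⊕_) (·ᵣ-zeroʳ M)) (⊕-identityʳ v)

act-∘ₐ : ∀ {n} (g h : Aff n) x → act (g ∘ₐ h) x ≡ act g (act h x)
act-∘ₐ (M , v) (N , u) x = begin
  (v ⊕ (M ·ᵥ u)) ⊕ ((M ⊗ N) ·ᵥ x)      ≡⟨ cong ((v ⊕ (M ·ᵥ u)) ⊕_) (⊗-·ᵥ M N x) ⟩
  (v ⊕ (M ·ᵥ u)) ⊕ (M ·ᵥ (N ·ᵥ x))     ≡⟨ ⊕-assoc v _ _ ⟩
  v ⊕ ((M ·ᵥ u) ⊕ (M ·ᵥ (N ·ᵥ x)))     ≡⟨ cong (v ⊕_) (·ᵣ-distribˡ-⊕ M u (N ·ᵥ x)) ⟨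
  v ⊕ (M ·ᵥ (u ⊕ (N ·ᵥ x)))            ∎

leftInverse-act : ∀ {n} (h g : Aff n) → h ∘ₐ g ≡ identityₐ n → act h (proj₂ g) ≡ zeros n
leftInverse-act {n} h g hg≡1 = begin
  act h (proj₂ g)              ≡⟨ cong (act h) (act-zeros g) ⟨
  act h (act g (zeros n))      ≡⟨ act-∘ₐ h g (zeros n) ⟨
  act (h ∘ₐ g) (zeros n)       ≡⟨ cong (λ k → act k (zeros n)) hg≡1 ⟩
  act (identityₐ n) (zeros n)  ≡⟨ act-zeros (identityₐ n) ⟩
  zeros n                      ∎

∘ₐ-isMonoid : ∀ n → IsMonoid _≡_ _∘ₐ_ (identityₐ n)
∘ₐ-isMonoid n = record
  { isSemigroup = record
    { isMagma = isMagma _∘ₐ_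
    ; assoc   = λ (L , u) (M , v) (N , w) → cong₂ _,_ (⊗-assoc L M N) (act-∘ₐ (L , u) (M , v) w)
    }
  ; identity =
    (λ (M , v) → cong₂ _,_ (⊗-identityˡ M) (trans (⊕-identityˡ _) (identity-·ᵥ v))) ,
    (λ (M , v) → cong₂ _,_ (⊗-identityʳ M) (act-zeros (M , v)))
  }

module ∘ₐ-Units {n} = MonoidUnits (∘ₐ-isMonoid n)

inCentralizer-∘ₐ : ∀ {n} {g h : Aff n} → InCentralizer n g → InCentralizer n h → InCentralizer n (g ∘ₐ h)
inCentralizer-∘ₐ (g-inv , gc≡cg) (h-inv , hc≡ch) = ⊗-Units.isUnit-∙ g-inv h-inv , ∘ₐ-Units.∙-commutes gc≡cg hc≡ch

inCentralizer-inverse : ∀ {n} {g : Aff n} → InCentralizer n g →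
                        Σ (Aff n) λ h → InCentralizer n h × h ∘ₐ g ≡ identityₐ n
inCentralizer-inverse {n} {M , v} ((N , MN≡1 , NM≡1) , gc≡cg) =
  g⁻¹ , ((M , NM≡1 , MN≡1) , ∘ₐ-Units.inverse-commutes gg⁻¹≡1 g⁻¹g≡1 gc≡cg) , g⁻¹g≡1
  where
  g⁻¹ = N , N ·ᵥ v

  gg⁻¹≡1 : (M , v) ∘ₐ g⁻¹ ≡ identityₐ n
  gg⁻¹≡1 = cong₂ _,_ MN≡1 (begin
    v ⊕ (M ·ᵥ (N ·ᵥ v))   ≡⟨ cong (v ⊕_) (⊗-·ᵥ M N v) ⟨
    v ⊕ ((M ⊗ N) ·ᵥ v)    ≡⟨ cong (λ P → v ⊕ (P ·ᵥ v)) MN≡1 ⟩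
    v ⊕ (identity n ·ᵥ v) ≡⟨ cong (v ⊕_) (identity-·ᵥ v) ⟩
    v ⊕ v                 ≡⟨ ⊕-self v ⟩
    zeros n               ∎)

  g⁻¹g≡1 : g⁻¹ ∘ₐ (M , v) ≡ identityₐ n
  g⁻¹g≡1 = cong₂ _,_ NM≡1 (⊕-self (N ·ᵥ v))

-- The centralizer of c

-- The matrix part is forced: its first row is the reverse of eₙ + S v = tail v ∷ʳ 1.
centralizerElement : ∀ {n} → Vect (suc n) → Aff (suc n)
centralizerElement v = toeplitz (true ∷ reverse (tail v)) , v

centralizerElement-inCentralizer : ∀ {n} (v : Vect (suc n)) → InCentralizer (suc n) (centralizerElement v)
centralizerElement-inCentralizer {n} v =
  upperUnitriangular⇒isInvertible (toeplitz-upperUnitriangular (reverse (tail v))) ,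
  Equivalence.from (commutes-cElt⇔ M v) (toeplitz-isUpperToeplitz (true ∷ reverse (tail v)) , lastColumn)
  where
  M = toeplitz (true ∷ reverse (tail v))
  lastColumn : M ·ᵥ eLast (suc n) ≡ eLast (suc n) ⊕ pushʳ false v
  lastColumn = begin
    M ·ᵥ eLast (suc n)                 ≡⟨ toeplitz-·ᵥ-eLast (true ∷ reverse (tail v)) ⟩
    reverse (true ∷ reverse (tail v))  ≡⟨ reverse-∷-reverse true (tail v) ⟩
    tail v ∷ʳ true                     ≡⟨ eLast-⊕-pushʳ v ⟨
    eLast (suc n) ⊕ pushʳ false v      ∎

inCentralizer⇒centralizerElement : ∀ {n} (g : Aff (suc n)) → InCentralizer (suc n) g →
                                   g ≡ centralizerElement (proj₂ g)
inCentralizer⇒centralizerElement {n} (M , v) (_ , gc≡cg)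
  with Equivalence.to (commutes-cElt⇔ M v) gc≡cg
... | toeplitz-M , lastColumn = cong (_, v) (trans (isUpperToeplitz⇒toeplitz M toeplitz-M) (cong toeplitz firstRow))
  where
  firstRow : head M ≡ true ∷ reverse (tail v)
  firstRow = reverse-injective (begin
    reverse (head M)                    ≡⟨ toeplitz-·ᵥ-eLast (head M) ⟨
    toeplitz (head M) ·ᵥ eLast (suc n)  ≡⟨ cong (_·ᵥ eLast (suc n)) (isUpperToeplitz⇒toeplitz M toeplitz-M) ⟨
    M ·ᵥ eLast (suc n)                  ≡⟨ lastColumn ⟩
    eLast (suc n) ⊕ pushʳ false v       ≡⟨ eLast-⊕-pushʳ v ⟩
    tail v ∷ʳ true                      ≡⟨ reverse-∷-reverse true (tail v) ⟨
    reverse (true ∷ reverse (tail v))   ∎)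

centralizer-transitive : ∀ {n} (w w′ : Vect (suc n)) →
                         Σ (Aff (suc n)) λ g → InCentralizer (suc n) g × act g w ≡ w′
centralizer-transitive {n} w w′ =
  let h , h∈C , hg≡1 = inCentralizer-inverse (centralizerElement-inCentralizer w) in
  g′ ∘ₐ h , inCentralizer-∘ₐ (centralizerElement-inCentralizer w′) h∈C , moves h hg≡1
  where
  g′ = centralizerElement w′
  moves : ∀ h → h ∘ₐ centralizerElement w ≡ identityₐ (suc n) → act (g′ ∘ₐ h) w ≡ w′
  moves h hg≡1 = begin
    act (g′ ∘ₐ h) w          ≡⟨ act-∘ₐ g′ h w ⟩
    act g′ (act h w)         ≡⟨ cong (act g′) (leftInverse-act h (centralizerElement w) hg≡1) ⟩
    act g′ (zeros (suc n))   ≡⟨ act-zeros g′ ⟩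
    w′                       ∎

allVectors : ∀ n → List (Vect n)
allVectors zero    = [ [] ]
allVectors (suc n) = List.map (true ∷_) (allVectors n) ++ List.map (false ∷_) (allVectors n)

∈-allVectors : ∀ {n} (v : Vect n) → v ∈ allVectors n
∈-allVectors []                  = here refl
∈-allVectors (true ∷ v)          = ∈-++⁺ˡ (∈-map⁺ (true ∷_) (∈-allVectors v))
∈-allVectors {suc n} (false ∷ v) =
  ∈-++⁺ʳ (List.map (true ∷_) (allVectors n)) (∈-map⁺ (false ∷_) (∈-allVectors v))

allVectors-unique : ∀ n → Unique (allVectors n)
allVectors-unique zero    = [] ∷ []
allVectors-unique (suc n) =
  Unique.++⁺ (Unique.map⁺ ∷-injectiveʳ (allVectors-unique n)) (Unique.map⁺ ∷-injectiveʳ (allVectors-unique n))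
             heads-differ
  where
  heads-differ : ∀ {v} → v ∈ List.map (true ∷_) (allVectors n) × v ∈ List.map (false ∷_) (allVectors n) → ⊥
  heads-differ (v∈t , v∈f) with ∈-map⁻ (true ∷_) v∈t | ∈-map⁻ (false ∷_) v∈f
  ... | _ , _ , v≡t∷ | _ , _ , v≡f∷ with ∷-injectiveˡ (trans (sym v≡t∷) v≡f∷)
  ... | ()

length-allVectors : ∀ n → length (allVectors n) ≡ 2 ^ n
length-allVectors zero    = refl
length-allVectors (suc n) = begin
  length (List.map (true ∷_) vs ++ List.map (false ∷_) vs)           ≡⟨ List.length-++ (List.map (true ∷_) vs) ⟩
  length (List.map (true ∷_) vs) + length (List.map (false ∷_) vs)   ≡⟨ cong₂ _+_ (List.length-map _ vs) (List.length-map _ vs) ⟩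
  length vs + length vs                                              ≡⟨ cong₂ _+_ (length-allVectors n) (trans (length-allVectors n) (sym (+-identityʳ _))) ⟩
  2 ^ suc n                                                          ∎
  where
  vs = allVectors n

lemma5p3 : (n : ℕ) → 1 ≤ n →
    ((w w′ : Vect n) → Σ (Aff n) (λ g → InCentralizer n g × (act g w ≡ w′)))
    × Σ (List (Aff n)) (λ L → Unique L × (length L ≡ 2 ^ n)
        × ((g : Aff n) → (g ∈ L) ⇔ InCentralizer n g))
lemma5p3 zero    ()
lemma5p3 (suc n) _ = centralizer-transitive , L , L-unique , L-length , L-members
  where
  L : List (Aff (suc n))
  L = List.map centralizerElement (allVectors (suc n))

  L-unique : Unique L
  L-unique = Unique.map⁺ (cong proj₂) (allVectors-unique (suc n))

  L-length : length L ≡ 2 ^ suc n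
  L-length = trans (List.length-map centralizerElement (allVectors (suc n))) (length-allVectors (suc n))

  L-members : (g : Aff (suc n)) → (g ∈ L) ⇔ InCentralizer (suc n) g
  L-members g = mk⇔
    (λ g∈L → let v , _ , g≡ = ∈-map⁻ centralizerElement g∈L in
             subst (InCentralizer (suc n)) (sym g≡) (centralizerElement-inCentralizer v))
    (λ g-central → subst (_∈ L) (sym (inCentralizer⇒centralizerElement g g-central))
                         (∈-map⁺ centralizerElement (∈-allVectors (proj₂ g))))
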